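{- Let $\mathcal{C}$ be a flag code of type $(t_1,\dots,t_r)$ on $\mathbb{F}_q^n$ and suppose that for some $i\in\{1,\dots,r\}$ the projected code $\mathcal{C}_i$ is a constant dimension code of maximum distance. Take flags $\mathcal{F}=(\mathcal{F}_1,\dots,\mathcal{F}_r),\mathcal{F}'=(\mathcal{F}'_1,\dots,\mathcal{F}'_r)\in\mathcal{C}$ with $\mathcal{F}_i\neq\mathcal{F}'_i$. (a) If $2t_i\leq n$, then $d_S(\mathcal{F}_j,\mathcal{F}'_j)=2t_j$ for every $1\leq j\leq i$. In particular, $|\mathcal{C}_i|\leq|\mathcal{C}_j|$ for $1\leq j\leq i$. (b) If $2t_i\geq n$, then $d_S(\mathcal{F}_j,\mathcal{F}'_j)=2(n-t_j)$ for every $i\leq j\leq r$. As a consequence, $|\mathcal{C}_i|\leq|\mathcal{C}_j|$ for $i\leq j\leq r$.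
   Context: $\mathbb{F}_q$ is the finite field with $q$ elements, and $\mathcal{G}_q(k,n)$ denotes the set of $k$-dimensional subspaces of $\mathbb{F}_q^n$. The subspace distance is $d_S(\mathcal{U},\mathcal{V})=\dim(\mathcal{U}+\mathcal{V})-\dim(\mathcal{U}\cap\mathcal{V})$. A constant dimension code is a nonempty $\mathcal{C}\subseteq\mathcal{G}_q(k,n)$; its minimum distance $d_S(\mathcal{C})$ is the minimum distance between distinct elements (and $0$ if $|\mathcal{C}|=1$). It is of maximum distance if $d_S(\mathcal{C})=2k$ when $2k\leq n$ and $d_S(\mathcal{C})=2(n-k)$ when $2k\geq n$. Given integers $0<t_1<\dots<t_r<n$, a flag of type $(t_1,\dots,t_r)$ on $\mathbb{F}_q^n$ is a sequence $\mathcal{F}=(\mathcal{F}_1,\dots,\mathcal{F}_r)$ of subspaces with $\mathcal{F}_1\subsetneq\cdots\subsetneq\mathcal{F}_r$ and $\dim\mathcal{F}_i=t_i$. A flag code of type $(t_1,\dots,t_r)$ is a nonempty set $\mathcal{C}$ of such flags; its $i$-th projected code is $\mathcal{C}_i=\{\mathcal{F}_i\mid \mathcal{F}\in\mathcal{C}\}\subseteq\mathcal{G}_q(t_i,n)$. -}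

module Defs where

open import Level using (0ℓ)
open import Data.Nat as ℕ using (ℕ; zero; suc; _∸_)
open import Data.Fin as Fin using (Fin)
open import Data.Vec as Vec using (Vec; []; _∷_; zipWith; replicate; map; foldr; lookup)
open import Data.List as List using (List)
open import Data.List.Membership.Propositional using (_∈_)
open import Data.List.Relation.Unary.AllPairs using (AllPairs)
open import Data.Product using (Σ; ∃; ∃-syntax; _×_; _,_)
open import Data.Sum using (_⊎_)
open import Function.Bundles using (_↔_)
open import Relation.Nullary using (¬_)
open import Relation.Binary.PropositionalEquality using (_≡_)
open import Algebra.Structures using (IsCommutativeRing)

record FiniteField : Set₁ where
  field
    Carrier : Set
    _+_ _*_ : Carrier → Carrier → Carrier
    -_      : Carrier → Carrier
    0# 1#   : Carrier
    isCommutativeRing : IsCommutativeRing _≡_ _+_ _*_ -_ 0# 1#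
    0≢1     : ¬ (0# ≡ 1#)
    inverse : ∀ x → ¬ (x ≡ 0#) → Σ Carrier (λ y → x * y ≡ 1#)
    size    : ℕ
    enum    : Fin size ↔ Carrier

module LinearAlgebra (𝔽 : FiniteField) (n : ℕ) where
  open FiniteField 𝔽

  V : Set
  V = Vec Carrier n

  zeroV : V
  zeroV = replicate n 0#

  _⊕_ : V → V → V
  _⊕_ = zipWith _+_

  _⊙_ : Carrier → V → V
  c ⊙ v = map (c *_) v

  lincomb : ∀ {k} → Vec Carrier k → Vec V k → V
  lincomb []       []       = zeroV
  lincomb (c ∷ cs) (b ∷ bs) = (c ⊙ b) ⊕ lincomb cs bs

  record Subspace : Set₁ where
    field
      mem     : V → Set
      0∈      : mem zeroV
      ⊕-closed : ∀ {u v} → mem u → mem v → mem (u ⊕ v)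
      ⊙-closed : ∀ c {v} → mem v → mem (c ⊙ v)
  open Subspace public

  _⊆_ : Subspace → Subspace → Set
  U ⊆ W = ∀ v → mem U v → mem W v

  _≈_ : Subspace → Subspace → Set
  U ≈ W = (U ⊆ W) × (W ⊆ U)

  _⊊_ : Subspace → Subspace → Set
  U ⊊ W = (U ⊆ W) × ¬ (W ⊆ U)

  HasDimP : (V → Set) → ℕ → Set
  HasDimP P k = Σ (Vec V k) λ b →
      (∀ i → P (lookup b i))
    × (∀ cs → lincomb cs b ≡ zeroV → ∀ i → lookup cs i ≡ 0#)
    × (∀ v → P v → Σ (Vec Carrier k) λ cs → v ≡ lincomb cs b)

  HasDim : Subspace → ℕ → Set
  HasDim U k = HasDimP (mem U) k

  sumMem : Subspace → Subspace → V → Set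
  sumMem U W v = Σ V λ u → Σ V λ w → mem U u × mem W w × (v ≡ u ⊕ w)

  capMem : Subspace → Subspace → V → Set
  capMem U W v = mem U v × mem W v

  DistS : Subspace → Subspace → ℕ → Set
  DistS U W d = Σ ℕ λ a → Σ ℕ λ b →
    HasDimP (sumMem U W) a × HasDimP (capMem U W) b × (d ≡ a ∸ b)

  -- minimum distance of a (nonempty) finite family of subspaces, considered as
  -- a set (elements up to ≈).  0 if it has only one element.
  MinDist : List Subspace → ℕ → Set₁
  MinDist C d =
      ((∀ {U W} → U ∈ C → W ∈ C → U ≈ W) × (d ≡ 0))
    ⊎ ((Σ Subspace λ U → Σ Subspace λ W → U ∈ C × W ∈ C × ¬ (U ≈ W) × DistS U W d)
       × (∀ {U W} → U ∈ C → W ∈ C → ¬ (U ≈ W) → ∀ e → DistS U W e → d ℕ.≤ e))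

  IsConstDimCode : ℕ → List Subspace → Set₁
  IsConstDimCode k C = ¬ (C ≡ List.[]) × (∀ {U} → U ∈ C → HasDim U k)

  IsMaxDistCode : ℕ → List Subspace → Set₁
  IsMaxDistCode k C = IsConstDimCode k C
    × (2 ℕ.* k ℕ.≤ n → MinDist C (2 ℕ.* k))
    × (n ℕ.≤ 2 ℕ.* k → MinDist C (2 ℕ.* (n ∸ k)))

  Card : List Subspace → ℕ → Set₁
  Card C m = Σ (List Subspace) λ ys →
      (List.length ys ≡ m)
    × AllPairs (λ U W → ¬ (U ≈ W)) ys
    × (∀ {U} → U ∈ ys → Σ Subspace λ W → W ∈ C × U ≈ W)
    × (∀ {W} → W ∈ C → Σ Subspace λ U → U ∈ ys × W ≈ U)

  CardLe : List Subspace → List Subspace → Set₁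
  CardLe C D = Σ ℕ λ a → Σ ℕ λ b → Card C a × Card D b × a ℕ.≤ b

  -- type (t_1,...,t_r) : 0 < t_1 < ... < t_r < n  (indexed by Fin r, 0-based)
  IsFlagType : ∀ {r} → (Fin r → ℕ) → Set
  IsFlagType {r} t = (∀ j → 0 ℕ.< t j) × (∀ j → t j ℕ.< n)
                   × (∀ j k → j Fin.< k → t j ℕ.< t k)

  record Flag {r : ℕ} (t : Fin r → ℕ) : Set₁ where
    field
      sub    : Fin r → Subspace
      dims   : ∀ j → HasDim (sub j) (t j)
      nested : ∀ j k → j Fin.< k → sub j ⊊ sub k
  open Flag public

  IsFlagCode : ∀ {r} {t : Fin r → ℕ} → List (Flag t) → Set₁
  IsFlagCode C = ¬ (C ≡ List.[])

  proj : ∀ {r} {t : Fin r → ℕ} → List (Flag t) → Fin r → List Subspace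
  proj C i = List.map (λ F → sub F i) C

-- Everything rests on the Grassmann formula dim (U + W) + dim (U ∩ W) = dim U + dim W: two
-- t-dimensional subspaces U ≠ W are at distance 2 (t − dim (U ∩ W)) and their sum has dimension
-- 2 t − dim (U ∩ W). If C_i has minimum distance 2 t_i, then F_i ∩ F'_i = 0, hence F_j ∩ F'_j = 0
-- for j ≤ i; if it has minimum distance 2 (n − t_i), then F_i + F'_i = F_q^n, hence
-- F_j + F'_j = F_q^n for j ≥ i. Either way F_j ≠ F'_j (as 0 < t_j < n), so F ↦ F_j is injective on
-- the classes of C_i, which bounds |C_i| by |C_j|. Dimension is well defined because F_q is finite:
-- l independent vectors in the span of k vectors give q ^ l distinct combinations among q ^ k, so
-- l ≤ k; bases of subspaces are then found by exhaustive search.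

module Submission where

open import Defs
open import Data.Nat using (ℕ; _*_; _∸_; _≤_)
open import Data.Fin using (Fin) renaming (_≤_ to _≤ᶠ_)
open import Data.List using (List)
open import Data.List.Membership.Propositional using (_∈_)
open import Data.Product using (_×_)
open import Relation.Nullary using (¬_)

open import Relation.Nullary using (Dec; contradiction; yes; no)
open import Relation.Nullary.Decidable using (map′; _×-dec_; ¬?; decidable-stable)

open import Data.Nat using (zero; suc; _+_; _^_; _<_; z≤n; s≤s)
import Data.Nat.Properties as ℕ
import Data.Fin as Fin
import Data.Fin.Properties as Fin
open import Data.Vec as Vec using (Vec; []; _∷_; _++_; lookup; replicate; zipWith)
import Data.Vec.Properties as Vec
open import Data.List as List using ([]; _∷_; [_]; length; cartesianProductWith)
import Data.List.Properties as List
open import Data.List.Relation.Unary.Any as Any using (Any; here; there)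
import Data.List.Relation.Unary.Any.Properties as Any
import Data.List.Relation.Unary.All as ListAll
open import Data.List.Relation.Unary.AllPairs using (AllPairs; []; _∷_)
import Data.List.Relation.Unary.AllPairs.Properties as AllPairs
open import Data.List.Relation.Unary.Unique.DecSetoid.Properties using (deduplicate-!)
open import Data.List.Relation.Unary.Unique.Propositional using (Unique)
import Data.List.Relation.Unary.Unique.Propositional.Properties as Unique
open import Data.List.Membership.Propositional using (find)
open import Data.List.Membership.Propositional.Properties
  using (∈-∃++; ∈-map⁺; ∈-map⁻; ∈-allFin; ∈-cartesianProductWith⁺; ∈-deduplicate⁻)
open import Data.Product using (Σ; _,_; proj₁; proj₂)
open import Data.Sum using (inj₁; inj₂)
open import Data.Empty using (⊥-elim)
open import Function using (_∘_)
open import Function.Bundles using (Inverse)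
import Level
import Relation.Binary.Construct.On as On
open import Level using (0ℓ)
open import Algebra.Bundles using (AbelianGroup)
open import Algebra.Structures using (IsCommutativeRing)
import Algebra.Properties.Group as GroupProperties
import Algebra.Properties.CommutativeSemigroup as CommutativeSemigroupProperties
open import Relation.Binary using (Rel; Symmetric; Transitive; DecidableEquality; IsEquivalence; DecSetoid)
open import Relation.Binary.PropositionalEquality hiding ([_])

length-≤-cover : ∀ {a ℓ} {A : Set a} {R : Rel A ℓ} → Symmetric R → Transitive R →
                 ∀ {xs ys} → AllPairs (λ x y → ¬ R x y) xs →
                 (∀ {x} → x ∈ xs → Any (R x) ys) → length xs ≤ length ys
length-≤-cover sym trans {[]} _ _ = z≤n
length-≤-cover {R = R} sym trans {x ∷ xs} (x≁xs ∷ xs-distinct) cover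
  with y , y∈ys , xRy ← find (cover (here refl))
  with ys₁ , ys₂ , refl ← ∈-∃++ y∈ys =
    begin
      suc (length xs)                 ≤⟨ s≤s (length-≤-cover sym trans xs-distinct cover′) ⟩
      suc (length (ys₁ List.++ ys₂))  ≡⟨ cong suc (List.length-++ ys₁) ⟩
      suc (length ys₁ + length ys₂)   ≡⟨ ℕ.+-suc (length ys₁) (length ys₂) ⟨
      length ys₁ + length (y ∷ ys₂)   ≡⟨ List.length-++ ys₁ ⟨
      length (ys₁ List.++ y ∷ ys₂)    ∎
  where
  open ℕ.≤-Reasoning
  cover′ : ∀ {z} → z ∈ xs → Any (R z) (ys₁ List.++ ys₂)
  cover′ z∈xs with Any.++⁻ ys₁ (cover (there z∈xs))
  ... | inj₁ p         = Any.++⁺ˡ p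
  ... | inj₂ (here zRy) = contradiction (trans xRy (sym zRy)) (ListAll.lookup x≁xs z∈xs)
  ... | inj₂ (there p) = Any.++⁺ʳ ys₁ p

module _ {a b ℓ ℓ′} {A : Set a} {R : Rel A ℓ} {S : Rel A ℓ′} {P : A → Set b} where

  allPairs-restrict : (∀ {x y} → P x → P y → R x y → S x y) → ∀ {xs} → ListAll.All P xs → AllPairs R xs → AllPairs S xs
  allPairs-restrict f ListAll.[]         []                = []
  allPairs-restrict f (px ListAll.∷ pxs) (Rx ∷ R-pairwise) =
    ListAll.zipWith (λ (py , Rxy) → f px py Rxy) (pxs , Rx) ∷ allPairs-restrict f pxs R-pairwise

length-cartesianProductWith : ∀ {A B C : Set} (f : A → B → C) xs ys →
  length (cartesianProductWith f xs ys) ≡ length xs * length ys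
length-cartesianProductWith f []       ys = refl
length-cartesianProductWith f (x ∷ xs) ys = begin
  length (List.map (f x) ys List.++ cartesianProductWith f xs ys)
    ≡⟨ List.length-++ (List.map (f x) ys) ⟩
  length (List.map (f x) ys) + length (cartesianProductWith f xs ys)
    ≡⟨ cong₂ _+_ (List.length-map (f x) ys) (length-cartesianProductWith f xs ys) ⟩
  length ys + length xs * length ys ∎
  where open ≡-Reasoning

module _ {A : Set} (xs : List A) where

  vectors : ∀ k → List (Vec A k)
  vectors zero    = [ [] ]
  vectors (suc k) = cartesianProductWith _∷_ xs (vectors k)

  ∈-vectors : (∀ x → x ∈ xs) → ∀ {k} (v : Vec A k) → v ∈ vectors k
  ∈-vectors all []      = here refl
  ∈-vectors all (x ∷ v) = ∈-cartesianProductWith⁺ _∷_ (all x) (∈-vectors all v)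

  vectors-unique : Unique xs → ∀ k → Unique (vectors k)
  vectors-unique !xs zero    = ListAll.[] ∷ []
  vectors-unique !xs (suc k) = Unique.cartesianProductWith⁺ _∷_ Vec.∷-injective !xs (vectors-unique !xs k)

  length-vectors : ∀ k → length (vectors k) ≡ length xs ^ k
  length-vectors zero    = refl
  length-vectors (suc k) = trans (length-cartesianProductWith _∷_ xs (vectors k))
                                 (cong (length xs *_) (length-vectors k))

module _ {A : Set} (P : A → Set) where

  lookup-++⁺ : ∀ {k l} (X : Vec A k) {Y : Vec A l} →
               (∀ i → P (lookup X i)) → (∀ i → P (lookup Y i)) → ∀ i → P (lookup (X ++ Y) i)
  lookup-++⁺ []      PX PY i           = PY i
  lookup-++⁺ (x ∷ X) PX PY Fin.zero    = PX Fin.zero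
  lookup-++⁺ (x ∷ X) PX PY (Fin.suc i) = lookup-++⁺ X (PX ∘ Fin.suc) PY i

  lookup-++ˡ⁻ : ∀ {k l} (X : Vec A k) {Y : Vec A l} → (∀ i → P (lookup (X ++ Y) i)) → ∀ i → P (lookup X i)
  lookup-++ˡ⁻ (x ∷ X) PXY Fin.zero    = PXY Fin.zero
  lookup-++ˡ⁻ (x ∷ X) PXY (Fin.suc i) = lookup-++ˡ⁻ X (PXY ∘ Fin.suc) i

^-cancelˡ-≤ : ∀ {m n o} → 1 < m → m ^ n ≤ m ^ o → n ≤ o
^-cancelˡ-≤ {m} 1<m mⁿ≤mᵒ = ℕ.≮⇒≥ (λ o<n → ℕ.<⇒≱ (ℕ.^-monoʳ-< m 1<m o<n) mⁿ≤mᵒ)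

module FieldVectors (𝔽 : FiniteField) where
  open FiniteField 𝔽 renaming (_+_ to _+ᶠ_; _*_ to _*ᶠ_; -_ to -ᶠ_)
  open IsCommutativeRing isCommutativeRing
    using (+-assoc; +-comm; +-identityˡ; +-identityʳ; distribˡ; distribʳ; *-assoc; *-comm;
           *-identityˡ; *-identityʳ; zeroˡ; zeroʳ; -‿inverseʳ)
  open Inverse enum using (to; from; strictlyInverseˡ; strictlyInverseʳ)

  infixl 6 _⊕_
  infixr 7 _⊙_
  infix  8 ⊖_

  𝟘 : ∀ m → Vec Carrier m
  𝟘 m = replicate m 0#

  _⊕_ : ∀ {m} → Vec Carrier m → Vec Carrier m → Vec Carrier m
  _⊕_ = zipWith _+ᶠ_

  _⊙_ : ∀ {m} → Carrier → Vec Carrier m → Vec Carrier m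
  c ⊙ v = Vec.map (c *ᶠ_) v

  ⊖_ : ∀ {m} → Vec Carrier m → Vec Carrier m
  ⊖ v = (-ᶠ 1#) ⊙ v

  private variable
    m k l : ℕ

  lincomb : ∀ {m k} → Vec Carrier k → Vec (Vec Carrier m) k → Vec Carrier m
  lincomb {m} = LinearAlgebra.lincomb 𝔽 m

  ⊕-comm : (u v : Vec Carrier m) → u ⊕ v ≡ v ⊕ u
  ⊕-comm = Vec.zipWith-comm +-comm

  ⊙-distribˡ-⊕ : ∀ c (u v : Vec Carrier m) → c ⊙ (u ⊕ v) ≡ c ⊙ u ⊕ c ⊙ v
  ⊙-distribˡ-⊕ c []      []      = refl
  ⊙-distribˡ-⊕ c (a ∷ u) (b ∷ v) = cong₂ _∷_ (distribˡ c a b) (⊙-distribˡ-⊕ c u v)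

  ⊙-distribʳ-+ : ∀ c d (v : Vec Carrier m) → (c +ᶠ d) ⊙ v ≡ c ⊙ v ⊕ d ⊙ v
  ⊙-distribʳ-+ c d []      = refl
  ⊙-distribʳ-+ c d (a ∷ v) = cong₂ _∷_ (distribʳ a c d) (⊙-distribʳ-+ c d v)

  *-⊙-assoc : ∀ c d (v : Vec Carrier m) → (c *ᶠ d) ⊙ v ≡ c ⊙ d ⊙ v
  *-⊙-assoc c d []      = refl
  *-⊙-assoc c d (a ∷ v) = cong₂ _∷_ (*-assoc c d a) (*-⊙-assoc c d v)

  ⊙-identityˡ : (v : Vec Carrier m) → 1# ⊙ v ≡ v
  ⊙-identityˡ []      = refl
  ⊙-identityˡ (a ∷ v) = cong₂ _∷_ (*-identityˡ a) (⊙-identityˡ v)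

  ⊙-zeroˡ : (v : Vec Carrier m) → 0# ⊙ v ≡ 𝟘 m
  ⊙-zeroˡ []      = refl
  ⊙-zeroˡ (a ∷ v) = cong₂ _∷_ (zeroˡ a) (⊙-zeroˡ v)

  ⊙-zeroʳ : ∀ c → c ⊙ 𝟘 m ≡ 𝟘 m
  ⊙-zeroʳ {m} c = trans (Vec.map-replicate (c *ᶠ_) 0# m) (cong (replicate m) (zeroʳ c))

  ⊕-inverseʳ : (v : Vec Carrier m) → v ⊕ ⊖ v ≡ 𝟘 m
  ⊕-inverseʳ v = begin
    v ⊕ ⊖ v                  ≡⟨ cong (_⊕ ⊖ v) (⊙-identityˡ v) ⟨
    1# ⊙ v ⊕ (-ᶠ 1#) ⊙ v     ≡⟨ ⊙-distribʳ-+ 1# (-ᶠ 1#) v ⟨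
    (1# +ᶠ (-ᶠ 1#)) ⊙ v      ≡⟨ cong (_⊙ v) (-‿inverseʳ 1#) ⟩
    0# ⊙ v                   ≡⟨ ⊙-zeroˡ v ⟩
    𝟘 _                      ∎
    where open ≡-Reasoning

  ⊕-abelianGroup : ℕ → AbelianGroup 0ℓ 0ℓ
  ⊕-abelianGroup m = record
    { Carrier = Vec Carrier m ; _≈_ = _≡_ ; _∙_ = _⊕_ ; ε = 𝟘 m ; _⁻¹ = ⊖_
    ; isAbelianGroup = record
      { isGroup = record
        { isMonoid = record
          { isSemigroup = record
            { isMagma = record { isEquivalence = isEquivalence ; ∙-cong = cong₂ _⊕_ }
            ; assoc   = Vec.zipWith-assoc +-assoc }
          ; identity = Vec.zipWith-identityˡ +-identityˡ , Vec.zipWith-identityʳ +-identityʳ }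
        ; inverse = (λ v → trans (⊕-comm (⊖ v) v) (⊕-inverseʳ v)) , ⊕-inverseʳ
        ; ⁻¹-cong = cong ⊖_ }
      ; comm = ⊕-comm } }

  module _ {m : ℕ} where
    open AbelianGroup (⊕-abelianGroup m) public
      using () renaming (assoc to ⊕-assoc; identityˡ to ⊕-identityˡ; identityʳ to ⊕-identityʳ)
    open GroupProperties (AbelianGroup.group (⊕-abelianGroup m)) public
      using (inverseˡ-unique; inverseʳ-unique; x∙y⁻¹≈ε⇒x≈y)
    open CommutativeSemigroupProperties (AbelianGroup.commutativeSemigroup (⊕-abelianGroup m)) public
      using (interchange)

  lincomb-𝟘 : (b : Vec (Vec Carrier m) k) → lincomb (𝟘 k) b ≡ 𝟘 m
  lincomb-𝟘 []      = refl
  lincomb-𝟘 (v ∷ b) = trans (cong₂ _⊕_ (⊙-zeroˡ v) (lincomb-𝟘 b)) (⊕-identityˡ _)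

  lincomb-⊕ : (cs ds : Vec Carrier k) (b : Vec (Vec Carrier m) k) →
              lincomb (cs ⊕ ds) b ≡ lincomb cs b ⊕ lincomb ds b
  lincomb-⊕ []       []       []      = sym (⊕-identityˡ _)
  lincomb-⊕ (c ∷ cs) (d ∷ ds) (v ∷ b) =
    trans (cong₂ _⊕_ (⊙-distribʳ-+ c d v) (lincomb-⊕ cs ds b))
          (interchange (c ⊙ v) (d ⊙ v) (lincomb cs b) (lincomb ds b))

  lincomb-⊙ : ∀ a (cs : Vec Carrier k) (b : Vec (Vec Carrier m) k) →
              lincomb (a ⊙ cs) b ≡ a ⊙ lincomb cs b
  lincomb-⊙ a []       []      = sym (⊙-zeroʳ a)
  lincomb-⊙ a (c ∷ cs) (v ∷ b) =
    trans (cong₂ _⊕_ (*-⊙-assoc a c v) (lincomb-⊙ a cs b)) (sym (⊙-distribˡ-⊕ a (c ⊙ v) (lincomb cs b)))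

  lincomb-++ : (cs : Vec Carrier k) (ds : Vec Carrier l) (b : Vec (Vec Carrier m) k) (b′ : Vec (Vec Carrier m) l) →
               lincomb (cs ++ ds) (b ++ b′) ≡ lincomb cs b ⊕ lincomb ds b′
  lincomb-++ []       ds []      b′ = sym (⊕-identityˡ _)
  lincomb-++ (c ∷ cs) ds (v ∷ b) b′ =
    trans (cong (c ⊙ v ⊕_) (lincomb-++ cs ds b b′)) (sym (⊕-assoc (c ⊙ v) (lincomb cs b) (lincomb ds b′)))

  lincomb-closed : (P : Vec Carrier m → Set) → P (𝟘 m) → (∀ {u v} → P u → P v → P (u ⊕ v)) →
                   (∀ c {v} → P v → P (c ⊙ v)) →
                   (cs : Vec Carrier k) (b : Vec (Vec Carrier m) k) → (∀ i → P (lookup b i)) →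
                   P (lincomb cs b)
  lincomb-closed P P𝟘 P⊕ P⊙ []       []      _  = P𝟘
  lincomb-closed P P𝟘 P⊕ P⊙ (c ∷ cs) (v ∷ b) Pb =
    P⊕ (P⊙ c (Pb Fin.zero)) (lincomb-closed P P𝟘 P⊕ P⊙ cs b (Pb ∘ Fin.suc))

  all-zero⇒𝟘 : {cs : Vec Carrier k} → (∀ i → lookup cs i ≡ 0#) → cs ≡ 𝟘 k
  all-zero⇒𝟘 {cs = []}     _  = refl
  all-zero⇒𝟘 {cs = c ∷ cs} z = cong₂ _∷_ (z Fin.zero) (all-zero⇒𝟘 (z ∘ Fin.suc))

  𝟘⇒all-zero : {cs : Vec Carrier k} → cs ≡ 𝟘 k → ∀ i → lookup cs i ≡ 0#
  𝟘⇒all-zero refl i = Vec.lookup-replicate i 0#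

  𝟘-++ : ∀ k l → 𝟘 (k + l) ≡ 𝟘 k ++ 𝟘 l
  𝟘-++ zero    l = refl
  𝟘-++ (suc k) l = cong (0# ∷_) (𝟘-++ k l)

  from-injective : ∀ {x y} → from x ≡ from y → x ≡ y
  from-injective {x} {y} eq = trans (sym (strictlyInverseˡ x)) (trans (cong to eq) (strictlyInverseˡ y))

  _≟_ : DecidableEquality Carrier
  x ≟ y = map′ from-injective (cong from) (from x Fin.≟ from y)

  Span : Vec (Vec Carrier m) k → Vec Carrier m → Set
  Span {k = k} b v = Σ (Vec Carrier k) λ cs → v ≡ lincomb cs b

  Independent : Vec (Vec Carrier m) k → Set
  Independent {m} {k} b = ∀ (cs : Vec Carrier k) → lincomb cs b ≡ 𝟘 m → ∀ i → lookup cs i ≡ 0#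

  span-lincomb : (b : Vec (Vec Carrier m) k) (cs : Vec Carrier l) (b′ : Vec (Vec Carrier m) l) →
                 (∀ i → Span b (lookup b′ i)) → Span b (lincomb cs b′)
  span-lincomb b = lincomb-closed (Span b) (𝟘 _ , sym (lincomb-𝟘 b))
    (λ { (cs , refl) (ds , refl) → cs ⊕ ds , sym (lincomb-⊕ cs ds b) })
    (λ { c (cs , refl) → c ⊙ cs , sym (lincomb-⊙ c cs b) })

  lincomb-injective : {b : Vec (Vec Carrier m) k} → Independent b →
                      ∀ {cs ds} → lincomb cs b ≡ lincomb ds b → cs ≡ ds
  lincomb-injective {b = b} ind {cs} {ds} eq = x∙y⁻¹≈ε⇒x≈y cs ds (all-zero⇒𝟘 (ind (cs ⊕ ⊖ ds) (begin
    lincomb (cs ⊕ ⊖ ds) b             ≡⟨ lincomb-⊕ cs (⊖ ds) b ⟩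
    lincomb cs b ⊕ lincomb (⊖ ds) b   ≡⟨ cong₂ _⊕_ eq (lincomb-⊙ (-ᶠ 1#) ds b) ⟩
    lincomb ds b ⊕ ⊖ lincomb ds b     ≡⟨ ⊕-inverseʳ (lincomb ds b) ⟩
    𝟘 _                               ∎)))
    where open ≡-Reasoning

  independent-∷ : {b : Vec (Vec Carrier m) k} {v : Vec Carrier m} →
                  Independent b → ¬ Span b v → Independent (v ∷ b)
  independent-∷ {b = b} {v} ind v∉b (c ∷ cs) eq with c ≟ 0#
  ... | yes refl = λ { Fin.zero → refl ; (Fin.suc i) → ind cs (trans (sym cs-part) eq) i }
    where
    cs-part : 0# ⊙ v ⊕ lincomb cs b ≡ lincomb cs b
    cs-part = trans (cong (_⊕ lincomb cs b) (⊙-zeroˡ v)) (⊕-identityˡ _)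
  ... | no c≢0 = contradiction (c⁻¹ ⊙ ⊖ cs , v≡) v∉b
    where
    c⁻¹ : Carrier
    c⁻¹ = proj₁ (inverse c c≢0)
    v≡ : v ≡ lincomb (c⁻¹ ⊙ ⊖ cs) b
    v≡ = begin
      v                          ≡⟨ ⊙-identityˡ v ⟨
      1# ⊙ v                     ≡⟨ cong (_⊙ v) (trans (sym (proj₂ (inverse c c≢0))) (*-comm c c⁻¹)) ⟩
      (c⁻¹ *ᶠ c) ⊙ v             ≡⟨ *-⊙-assoc c⁻¹ c v ⟩
      c⁻¹ ⊙ c ⊙ v                ≡⟨ cong (c⁻¹ ⊙_) (inverseˡ-unique (c ⊙ v) (lincomb cs b) eq) ⟩
      c⁻¹ ⊙ ⊖ lincomb cs b       ≡⟨ cong (c⁻¹ ⊙_) (lincomb-⊙ (-ᶠ 1#) cs b) ⟨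
      c⁻¹ ⊙ lincomb (⊖ cs) b     ≡⟨ lincomb-⊙ c⁻¹ (⊖ cs) b ⟨
      lincomb (c⁻¹ ⊙ ⊖ cs) b     ∎
      where open ≡-Reasoning

  scalars : List Carrier
  scalars = List.map to (List.allFin size)

  ∈-scalars : ∀ x → x ∈ scalars
  ∈-scalars x = subst (_∈ scalars) (strictlyInverseˡ x) (∈-map⁺ to (∈-allFin (from x)))

  scalars-unique : Unique scalars
  scalars-unique = Unique.map⁺ to-injective (Unique.allFin⁺ size)
    where
    to-injective : ∀ {i j} → to i ≡ to j → i ≡ j
    to-injective {i} {j} eq = trans (sym (strictlyInverseʳ i)) (trans (cong from eq) (strictlyInverseʳ j))

  length-scalars : length scalars ≡ size
  length-scalars = trans (List.length-map to (List.allFin size)) (List.length-tabulate (λ i → i))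

  1<size : 1 < size
  1<size = more-than-one from from-injective
    where
    more-than-one : ∀ {s} (f : Carrier → Fin s) → (∀ {x y} → f x ≡ f y → x ≡ y) → 1 < s
    more-than-one {zero}        f _   with f 0#
    ... | ()
    more-than-one {suc zero}    f inj with f 0# in eq₀ | f 1# in eq₁
    ... | Fin.zero | Fin.zero = contradiction (inj (trans eq₀ (sym eq₁))) 0≢1
    more-than-one {suc (suc _)} _ _   = s≤s (s≤s z≤n)

  coefficients : ∀ k → List (Vec Carrier k)
  coefficients = vectors scalars

  spanned : Vec (Vec Carrier m) k → List (Vec Carrier m)
  spanned {k = k} b = List.map (λ cs → lincomb cs b) (coefficients k)

  ∈-spanned : (b : Vec (Vec Carrier m) k) {v : Vec Carrier m} → Span b v → v ∈ spanned b
  ∈-spanned b (cs , refl) = ∈-map⁺ _ (∈-vectors scalars ∈-scalars cs)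

  span? : (b : Vec (Vec Carrier m) k) (v : Vec Carrier m) → Dec (Span b v)
  span? b v = map′ (λ v∈ → let cs , _ , eq = ∈-map⁻ _ v∈ in cs , eq) (∈-spanned b)
                   (Any.any? (Vec.≡-dec _≟_ v) (spanned b))

  independent-length-≤ : (b : Vec (Vec Carrier m) l) (c : Vec (Vec Carrier m) k) →
                         Independent b → (∀ i → Span c (lookup b i)) → l ≤ k
  -- The q ^ l combinations of b are distinct and lie among the q ^ k combinations of c.
  independent-length-≤ {m = m} {l = l} {k = k} b c ind b⊆c = ^-cancelˡ-≤ 1<size (begin
    size ^ l            ≡⟨ size-of b ⟨
    length (spanned b)  ≤⟨ length-≤-cover sym trans spanned-b-unique spanned-b⊆c ⟩
    length (spanned c)  ≡⟨ size-of c ⟩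
    size ^ k            ∎)
    where
    open ℕ.≤-Reasoning
    size-of : ∀ {j} (a : Vec (Vec Carrier m) j) → length (spanned a) ≡ size ^ j
    size-of {j} a = trans (List.length-map (λ cs → lincomb cs a) (coefficients j))
                          (trans (length-vectors scalars j) (cong (_^ j) length-scalars))
    spanned-b-unique : Unique (spanned b)
    spanned-b-unique = Unique.map⁺ (lincomb-injective ind) (vectors-unique scalars scalars-unique l)
    spanned-b⊆c : ∀ {v} → v ∈ spanned b → v ∈ spanned c
    spanned-b⊆c v∈ with ds , _ , refl ← ∈-map⁻ _ v∈ = ∈-spanned c (span-lincomb c ds b b⊆c)

  standardBasis : ∀ m → Vec (Vec Carrier m) m
  standardBasis zero    = []
  standardBasis (suc m) = (1# ∷ 𝟘 m) ∷ Vec.map (0# ∷_) (standardBasis m)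

  lincomb-map-0∷ : (cs : Vec Carrier k) (b : Vec (Vec Carrier m) k) →
                   lincomb cs (Vec.map (0# ∷_) b) ≡ 0# ∷ lincomb cs b
  lincomb-map-0∷ []       []      = refl
  lincomb-map-0∷ (c ∷ cs) (v ∷ b) =
    trans (cong (c ⊙ (0# ∷ v) ⊕_) (lincomb-map-0∷ cs b))
          (cong (_∷ c ⊙ v ⊕ lincomb cs b) (trans (+-identityʳ _) (zeroʳ c)))

  lincomb-standardBasis : (v : Vec Carrier m) → lincomb v (standardBasis m) ≡ v
  lincomb-standardBasis []       = refl
  lincomb-standardBasis {suc m} (c ∷ v) = begin
    c ⊙ (1# ∷ 𝟘 m) ⊕ lincomb v (Vec.map (0# ∷_) (standardBasis m))
      ≡⟨ cong (c ⊙ (1# ∷ 𝟘 m) ⊕_) (lincomb-map-0∷ v (standardBasis m)) ⟩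
    (c *ᶠ 1#) +ᶠ 0# ∷ c ⊙ 𝟘 m ⊕ lincomb v (standardBasis m)
      ≡⟨ cong₂ _∷_ (trans (+-identityʳ _) (*-identityʳ c))
                   (trans (cong (_⊕ _) (⊙-zeroʳ c)) (trans (⊕-identityˡ _) (lincomb-standardBasis v))) ⟩
    c ∷ v ∎
    where open ≡-Reasoning

  standardBasis-independent : ∀ m → Independent (standardBasis m)
  standardBasis-independent m cs eq = 𝟘⇒all-zero (trans (sym (lincomb-standardBasis cs)) eq)

  standardBasis-spans : (v : Vec Carrier m) → Span (standardBasis m) v
  standardBasis-spans v = v , sym (lincomb-standardBasis v)

module Subspaces (𝔽 : FiniteField) (n : ℕ) where
  open FiniteField 𝔽 using (Carrier; 0#; 1#; 0≢1)
  open FieldVectors 𝔽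
  open LinearAlgebra 𝔽 n
    using (V; Subspace; mem; 0∈; ⊕-closed; ⊙-closed; HasDimP; HasDim; sumMem; capMem; _⊆_; _≈_; DistS; MinDist)

  private variable
    k l s : ℕ
    P : V → Set

  IsBasis : (V → Set) → Vec V k → Set
  IsBasis P b = (∀ i → P (lookup b i)) × Independent b × (∀ v → P v → Span b v)

  dim-unique : HasDimP P k → HasDimP P l → k ≡ l
  dim-unique (b , b∈P , b-ind , P⊆b) (c , c∈P , c-ind , P⊆c) =
    ℕ.≤-antisym (independent-length-≤ b c b-ind (λ i → P⊆c _ (b∈P i)))
                (independent-length-≤ c b c-ind (λ i → P⊆b _ (c∈P i)))

  dim≤n : HasDimP P s → s ≤ n
  dim≤n (b , _ , b-ind , _) = independent-length-≤ b (standardBasis n) b-ind (λ _ → standardBasis-spans _)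

  full⇒dim-n : (∀ v → P v) → HasDimP P n
  full⇒dim-n full = standardBasis n , (λ _ → full _) , standardBasis-independent n , (λ v _ → standardBasis-spans v)

  dim-zero⇒trivial : HasDimP P 0 → ∀ v → P v → v ≡ 𝟘 n
  dim-zero⇒trivial ([] , _ , _ , P⊆[]) v v∈P with [] , eq ← P⊆[] v v∈P = eq

  nonzero-of-dim-suc : HasDimP P (suc s) → Σ V λ v → P v × ¬ (v ≡ 𝟘 n)
  nonzero-of-dim-suc {s = s} (v ∷ b , b∈P , b-ind , _) = v , b∈P Fin.zero , v≢𝟘
    where
    v≢𝟘 : ¬ (v ≡ 𝟘 n)
    v≢𝟘 refl = 0≢1 (sym (b-ind (1# ∷ 𝟘 s) 𝟘-combination Fin.zero))
      where
      𝟘-combination : 1# ⊙ 𝟘 n ⊕ lincomb (𝟘 s) b ≡ 𝟘 n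
      𝟘-combination = trans (cong₂ _⊕_ (⊙-zeroʳ 1#) (lincomb-𝟘 b)) (⊕-identityˡ _)

  trivial⇒dim-zero : HasDimP P s → (∀ v → P v → v ≡ 𝟘 n) → s ≡ 0
  trivial⇒dim-zero {s = zero}  _   _       = refl
  trivial⇒dim-zero {s = suc s} dim trivial with v , v∈P , v≢𝟘 ← nonzero-of-dim-suc dim =
    contradiction (trivial v v∈P) v≢𝟘

  lincomb∈ : (U : Subspace) (cs : Vec Carrier k) (b : Vec V k) → (∀ i → mem U (lookup b i)) → mem U (lincomb cs b)
  lincomb∈ U = lincomb-closed (mem U) (0∈ U) (⊕-closed U) (⊙-closed U)

  dim-n⇒full : (U : Subspace) → HasDim U n → ∀ v → mem U v
  dim-n⇒full U (b , b∈U , b-ind , _) v with span? b v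
  ... | yes (cs , refl) = lincomb∈ U cs b b∈U
  ... | no v∉b = ⊥-elim (ℕ.<-irrefl refl
    (independent-length-≤ (v ∷ b) (standardBasis n) (independent-∷ b-ind v∉b) (λ _ → standardBasis-spans _)))

  mem? : (U : Subspace) → HasDim U k → ∀ v → Dec (mem U v)
  mem? U (b , b∈U , _ , U⊆b) v = map′ (λ { (cs , refl) → lincomb∈ U cs b b∈U }) (U⊆b v) (span? b v)

  _∩ˢ_ : Subspace → Subspace → Subspace
  U ∩ˢ W = record
    { mem      = capMem U W
    ; 0∈       = 0∈ U , 0∈ W
    ; ⊕-closed = λ (u∈U , u∈W) (v∈U , v∈W) → ⊕-closed U u∈U v∈U , ⊕-closed W u∈W v∈W
    ; ⊙-closed = λ c (v∈U , v∈W) → ⊙-closed U c v∈U , ⊙-closed W c v∈W }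

  _+ˢ_ : Subspace → Subspace → Subspace
  U +ˢ W = record
    { mem      = sumMem U W
    ; 0∈       = 𝟘 n , 𝟘 n , 0∈ U , 0∈ W , sym (⊕-identityˡ _)
    ; ⊕-closed = λ { (u , w , u∈ , w∈ , refl) (u′ , w′ , u′∈ , w′∈ , refl) →
                     u ⊕ u′ , w ⊕ w′ , ⊕-closed U u∈ u′∈ , ⊕-closed W w∈ w′∈ , interchange u w u′ w′ }
    ; ⊙-closed = λ { c (u , w , u∈ , w∈ , refl) →
                     c ⊙ u , c ⊙ w , ⊙-closed U c u∈ , ⊙-closed W c w∈ , ⊙-distribˡ-⊕ c u w } }

  module _ (S : Subspace) (S? : ∀ v → Dec (mem S v)) (c : Vec V k) (S⊆c : ∀ v → mem S v → Span c v) where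

    extend-basis : (b : Vec V l) → (∀ i → mem S (lookup b i)) → Independent b →
                   Σ ℕ λ x → Σ (Vec V x) λ X → IsBasis (mem S) (X ++ b)
    extend-basis {l} b = grow k [] (ℕ.m≤n+m k l)
      where
      -- An independent family in S has at most k members, so k bounds the number of steps.
      grow : ∀ budget {x} (X : Vec V x) → k ≤ x + l + budget →
             (∀ i → mem S (lookup (X ++ b) i)) → Independent (X ++ b) →
             Σ ℕ λ x → Σ (Vec V x) λ X → IsBasis (mem S) (X ++ b)
      grow budget {x} X k≤ X∈S X-ind
        with Any.any? (λ v → S? v ×-dec ¬? (span? (X ++ b) v)) (spanned c)
      ... | no none = x , X , X∈S , X-ind , S⊆X
        where
        S⊆X : ∀ v → mem S v → Span (X ++ b) v
        S⊆X v v∈S = decidable-stable (span? (X ++ b) v)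
          (λ v∉X → none (Any.map (λ { refl → v∈S , v∉X }) (∈-spanned c (S⊆c v v∈S))))
      ... | yes found with v , v∈S , v∉X ← Any.satisfied found = add budget k≤
        where
        vX∈S : ∀ i → mem S (lookup (v ∷ X ++ b) i)
        vX∈S Fin.zero    = v∈S
        vX∈S (Fin.suc i) = X∈S i

        add : ∀ remaining → k ≤ x + l + remaining → Σ ℕ λ x → Σ (Vec V x) λ X → IsBasis (mem S) (X ++ b)
        add zero            k≤ = contradiction
          (independent-length-≤ (v ∷ X ++ b) c (independent-∷ X-ind v∉X) (λ i → S⊆c _ (vX∈S i)))
          (ℕ.≤⇒≯ (subst (k ≤_) (ℕ.+-identityʳ _) k≤))
        add (suc remaining) k≤ =
          grow remaining (v ∷ X) (subst (k ≤_) (ℕ.+-suc _ remaining) k≤) vX∈S (independent-∷ X-ind v∉X)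

    has-dim : Σ ℕ (HasDim S)
    has-dim with x , X , basis ← extend-basis [] (λ ()) (λ _ _ ()) = x , subst (HasDim S) (ℕ.+-identityʳ x) (X ++ [] , basis)

  ⊆-+ˡ : (U W : Subspace) → U ⊆ (U +ˢ W)
  ⊆-+ˡ U W u u∈U = u , 𝟘 n , u∈U , 0∈ W , sym (⊕-identityʳ u)

  ⊆-+ʳ : (U W : Subspace) → W ⊆ (U +ˢ W)
  ⊆-+ʳ U W w w∈W = 𝟘 n , w , 0∈ U , w∈W , sym (⊕-identityˡ w)

  +ˢ-mono : (U W U′ W′ : Subspace) → U ⊆ U′ → W ⊆ W′ → (U +ˢ W) ⊆ (U′ +ˢ W′)
  +ˢ-mono _ _ _ _ U⊆U′ W⊆W′ _ (u , w , u∈U , w∈W , eq) = u , w , U⊆U′ u u∈U , W⊆W′ w w∈W , eq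

  independent-++⇒𝟘 : {X : Vec V k} {Z : Vec V l} → Independent (X ++ Z) →
                     ∀ xs zs → lincomb xs X ⊕ lincomb zs Z ≡ 𝟘 n → xs ≡ 𝟘 k × zs ≡ 𝟘 l
  independent-++⇒𝟘 {k} {l} {X} {Z} ind xs zs eq =
    Vec.++-injective xs (𝟘 k) (trans (all-zero⇒𝟘 (ind (xs ++ zs) (trans (lincomb-++ xs zs X Z) eq))) (𝟘-++ k l))

  module SumBasis (U W : Subspace) {x y c} (X : Vec V x) (Y : Vec V y) (Z : Vec V c)
                  (Z-basis : IsBasis (capMem U W) Z)
                  (XZ-basis : IsBasis (mem U) (X ++ Z)) (YZ-basis : IsBasis (mem W) (Y ++ Z)) where

    private
      X∈U : ∀ i → mem U (lookup X i)
      X∈U = lookup-++ˡ⁻ (mem U) X (proj₁ XZ-basis)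
      Y∈W : ∀ i → mem W (lookup Y i)
      Y∈W = lookup-++ˡ⁻ (mem W) Y (proj₁ YZ-basis)
      Z∈U : ∀ i → mem U (lookup Z i)
      Z∈U i = proj₁ (proj₁ Z-basis i)

    in-sum : ∀ i → sumMem U W (lookup (X ++ Y ++ Z) i)
    in-sum = lookup-++⁺ (sumMem U W) X (⊆-+ˡ U W _ ∘ X∈U)
               (lookup-++⁺ (sumMem U W) Y (⊆-+ʳ U W _ ∘ Y∈W) (⊆-+ˡ U W _ ∘ Z∈U))

    -- A relation among X, Y, Z puts its Y-part in U ∩ W, hence in the span of Z alone.
    independent : Independent (X ++ Y ++ Z)
    independent cs eq with xs , rest , refl ← Vec.splitAt x cs with ys , zs , refl ← Vec.splitAt y rest =
      𝟘⇒all-zero (begin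
        xs ++ ys ++ zs        ≡⟨ cong₂ _++_ xs≡𝟘 (cong₂ _++_ ys≡𝟘 zs≡𝟘) ⟩
        𝟘 x ++ 𝟘 y ++ 𝟘 c     ≡⟨ trans (𝟘-++ x (y + c)) (cong (𝟘 x ++_) (𝟘-++ y c)) ⟨
        𝟘 (x + (y + c))       ∎)
      where
      open ≡-Reasoning
      lx ly lz : V
      lx = lincomb xs X
      ly = lincomb ys Y
      lz = lincomb zs Z
      relation : (lx ⊕ lz) ⊕ ly ≡ 𝟘 n
      relation = begin
        (lx ⊕ lz) ⊕ ly        ≡⟨ ⊕-assoc lx lz ly ⟩
        lx ⊕ (lz ⊕ ly)        ≡⟨ cong (lx ⊕_) (⊕-comm lz ly) ⟩
        lx ⊕ (ly ⊕ lz)        ≡⟨ cong (lx ⊕_) (lincomb-++ ys zs Y Z) ⟨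
        lx ⊕ lincomb (ys ++ zs) (Y ++ Z)   ≡⟨ lincomb-++ xs (ys ++ zs) X (Y ++ Z) ⟨
        lincomb (xs ++ ys ++ zs) (X ++ Y ++ Z) ≡⟨ eq ⟩
        𝟘 n                   ∎
      ly∈U : mem U ly
      ly∈U = subst (mem U) (sym (inverseʳ-unique (lx ⊕ lz) ly relation))
               (⊙-closed U _ (subst (mem U) (lincomb-++ xs zs X Z) (lincomb∈ U (xs ++ zs) (X ++ Z) (proj₁ XZ-basis))))
      ly∈W : mem W ly
      ly∈W = lincomb∈ W ys Y Y∈W
      ly∈Z : Span Z ly
      ly∈Z = proj₂ (proj₂ Z-basis) ly (ly∈U , ly∈W)
      ys≡𝟘 : ys ≡ 𝟘 y
      ys≡𝟘 with ds , ly≡ ← ly∈Z = proj₁ (independent-++⇒𝟘 (proj₁ (proj₂ YZ-basis)) ys (⊖ ds) (begin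
        ly ⊕ lincomb (⊖ ds) Z            ≡⟨ cong₂ _⊕_ ly≡ (lincomb-⊙ _ ds Z) ⟩
        lincomb ds Z ⊕ ⊖ lincomb ds Z    ≡⟨ ⊕-inverseʳ _ ⟩
        𝟘 n                              ∎))
      xz≡𝟘 : xs ≡ 𝟘 x × zs ≡ 𝟘 c
      xz≡𝟘 = independent-++⇒𝟘 (proj₁ (proj₂ XZ-basis)) xs zs (begin
        lx ⊕ lz           ≡⟨ ⊕-identityʳ _ ⟨
        (lx ⊕ lz) ⊕ 𝟘 n   ≡⟨ cong ((lx ⊕ lz) ⊕_) (trans (cong (λ cs → lincomb cs Y) ys≡𝟘) (lincomb-𝟘 Y)) ⟨
        (lx ⊕ lz) ⊕ ly    ≡⟨ relation ⟩
        𝟘 n               ∎)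
      xs≡𝟘 : xs ≡ 𝟘 x
      xs≡𝟘 = proj₁ xz≡𝟘
      zs≡𝟘 : zs ≡ 𝟘 c
      zs≡𝟘 = proj₂ xz≡𝟘

    spans : ∀ v → sumMem U W v → Span (X ++ Y ++ Z) v
    spans _ (u , w , u∈U , w∈W , refl)
      with a , u≡ ← proj₂ (proj₂ XZ-basis) u u∈U | b , w≡ ← proj₂ (proj₂ YZ-basis) w w∈W
      with as , az , refl ← Vec.splitAt x a | bs , bz , refl ← Vec.splitAt y b =
      as ++ bs ++ (az ⊕ bz) , (begin
        u ⊕ w                                 ≡⟨ cong₂ _⊕_ (trans u≡ (lincomb-++ as az X Z))
                                                             (trans w≡ (lincomb-++ bs bz Y Z)) ⟩
        (la ⊕ laz) ⊕ (lb ⊕ lbz)               ≡⟨ interchange la laz lb lbz ⟩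
        (la ⊕ lb) ⊕ (laz ⊕ lbz)               ≡⟨ ⊕-assoc la lb (laz ⊕ lbz) ⟩
        la ⊕ (lb ⊕ (laz ⊕ lbz))               ≡⟨ cong (λ z → la ⊕ (lb ⊕ z)) (lincomb-⊕ az bz Z) ⟨
        la ⊕ (lb ⊕ lincomb (az ⊕ bz) Z)       ≡⟨ cong (la ⊕_) (lincomb-++ bs (az ⊕ bz) Y Z) ⟨
        la ⊕ lincomb (bs ++ (az ⊕ bz)) (Y ++ Z) ≡⟨ lincomb-++ as (bs ++ (az ⊕ bz)) X (Y ++ Z) ⟨
        lincomb (as ++ bs ++ (az ⊕ bz)) (X ++ Y ++ Z) ∎)
      where
      open ≡-Reasoning
      la laz lb lbz : V
      la  = lincomb as X
      laz = lincomb az Z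
      lb  = lincomb bs Y
      lbz = lincomb bz Z

    isBasis : IsBasis (sumMem U W) (X ++ Y ++ Z)
    isBasis = in-sum , independent , spans

  record Grassmann (U W : Subspace) (a b : ℕ) : Set where
    field
      x y c  : ℕ
      capDim : HasDim (U ∩ˢ W) c
      sumDim : HasDim (U +ˢ W) (x + (y + c))
      dimU   : x + c ≡ a
      dimW   : y + c ≡ b

  opaque
    grassmann : (U W : Subspace) {a b : ℕ} → HasDim U a → HasDim W b → Grassmann U W a b
    grassmann U W dimU@(BU , _ , _ , U⊆BU) dimW@(BW , _ , _ , W⊆BW)
      with c , Z , Z-basis ← has-dim (U ∩ˢ W) (λ v → mem? U dimU v ×-dec mem? W dimW v)
                                     BU (λ v v∈ → U⊆BU v (proj₁ v∈))
      with x , X , XZ-basis ← extend-basis U (mem? U dimU) BU U⊆BU Z (proj₁ ∘ proj₁ Z-basis) (proj₁ (proj₂ Z-basis))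
         | y , Y , YZ-basis ← extend-basis W (mem? W dimW) BW W⊆BW Z (proj₂ ∘ proj₁ Z-basis) (proj₁ (proj₂ Z-basis))
      = record
        { capDim = Z , Z-basis
        ; sumDim = X ++ Y ++ Z , SumBasis.isBasis U W X Y Z Z-basis XZ-basis YZ-basis
        ; dimU   = dim-unique (X ++ Z , XZ-basis) dimU
        ; dimW   = dim-unique (Y ++ Z , YZ-basis) dimW }

  module _ {U W : Subspace} {a b : ℕ} (g : Grassmann U W a b) where
    open Grassmann g

    grassmann-distS : DistS U W (x + y)
    grassmann-distS = _ , _ , sumDim , capDim ,
      sym (trans (cong (_∸ c) (sym (ℕ.+-assoc x y c))) (ℕ.m+n∸n≡m (x + y) c))

  same-dim-grassmann : (U W : Subspace) {t : ℕ} → HasDim U t → HasDim W t →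
                       Σ ℕ λ x → Σ ℕ λ c → (x + c ≡ t) × HasDim (U ∩ˢ W) c × HasDim (U +ˢ W) (x + t)
                                           × DistS U W (2 * x)
  same-dim-grassmann U W {t} dimU dimW = x , c , dimU′ , capDim , subst (HasDim (U +ˢ W)) (cong (x +_) dimW′) sumDim ,
                                     subst (DistS U W) (cong (x +_) (trans y≡x (sym (ℕ.+-identityʳ x)))) (grassmann-distS g)
    where
    g : Grassmann U W t t
    g = grassmann U W dimU dimW
    open Grassmann g renaming (dimU to dimU′; dimW to dimW′)
    y≡x : y ≡ x
    y≡x = ℕ.+-cancelʳ-≡ c y x (trans dimW′ (sym dimU′))

  module _ (U W : Subspace) {t : ℕ} (dimU : HasDim U t) (dimW : HasDim W t) where

    cap-trivial-of-dist : (∀ e → DistS U W e → 2 * t ≤ e) → ∀ v → capMem U W v → v ≡ 𝟘 n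
    cap-trivial-of-dist bound with x , c , refl , capDim , _ , dist ← same-dim-grassmann U W dimU dimW =
      dim-zero⇒trivial (subst (HasDim (U ∩ˢ W)) c≡0 capDim)
      where
      c≡0 : c ≡ 0
      c≡0 = ℕ.n≤0⇒n≡0 (ℕ.+-cancelˡ-≤ x c 0 (subst (x + c ≤_) (sym (ℕ.+-identityʳ x))
              (ℕ.*-cancelˡ-≤ 2 (bound (2 * x) dist))))

    dist-of-cap-trivial : (∀ v → capMem U W v → v ≡ 𝟘 n) → DistS U W (2 * t)
    dist-of-cap-trivial trivial with x , c , refl , capDim , _ , dist ← same-dim-grassmann U W dimU dimW =
      subst (λ c → DistS U W (2 * (x + c))) (sym (trivial⇒dim-zero capDim trivial))
            (subst (λ x → DistS U W (2 * x)) (sym (ℕ.+-identityʳ x)) dist)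

    sum-full-of-dist : (∀ e → DistS U W e → 2 * (n ∸ t) ≤ e) → ∀ v → sumMem U W v
    sum-full-of-dist bound with x , c , refl , _ , sumDim , dist ← same-dim-grassmann U W dimU dimW =
      dim-n⇒full (U +ˢ W) (subst (HasDim (U +ˢ W)) x+t≡n sumDim)
      where
      t≤n : x + c ≤ n
      t≤n = ℕ.≤-trans (ℕ.m≤n+m (x + c) x) (dim≤n sumDim)
      x+t≡n : x + (x + c) ≡ n
      x+t≡n = ℕ.≤-antisym (dim≤n sumDim) (begin
        n                        ≡⟨ ℕ.m+[n∸m]≡n t≤n ⟨
        (x + c) + (n ∸ (x + c))  ≤⟨ ℕ.+-monoʳ-≤ (x + c) (ℕ.*-cancelˡ-≤ 2 (bound (2 * x) dist)) ⟩
        (x + c) + x              ≡⟨ ℕ.+-comm (x + c) x ⟩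
        x + (x + c)              ∎)
        where open ℕ.≤-Reasoning

    dist-of-sum-full : (∀ v → sumMem U W v) → DistS U W (2 * (n ∸ t))
    dist-of-sum-full full with x , c , refl , _ , sumDim , dist ← same-dim-grassmann U W dimU dimW =
      subst (λ d → DistS U W (2 * d)) (sym n∸t≡x) dist
      where
      n∸t≡x : n ∸ (x + c) ≡ x
      n∸t≡x = trans (cong (_∸ (x + c)) (dim-unique (full⇒dim-n full) sumDim)) (ℕ.m+n∸n≡m x (x + c))

  ⊆? : (U W : Subspace) {a b : ℕ} → HasDim U a → HasDim W b → Dec (U ⊆ W)
  ⊆? U W (BU , BU∈U , _ , U⊆BU) dimW = map′
    (λ BU⊆W v v∈U → let cs , v≡ = U⊆BU v v∈U in subst (mem W) (sym v≡) (lincomb∈ W cs BU BU⊆W))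
    (λ U⊆W i → U⊆W _ (BU∈U i))
    (Fin.all? (λ i → mem? W dimW (lookup BU i)))

  ≈? : (U W : Subspace) {a b : ℕ} → HasDim U a → HasDim W b → Dec (U ≈ W)
  ≈? U W dimU dimW = ⊆? U W dimU dimW ×-dec ⊆? W U dimW dimU

  minDist≤ : ∀ {D d} → MinDist D d → ∀ {U W} → U ∈ D → W ∈ D → ¬ U ≈ W → ∀ e → DistS U W e → d ≤ e
  minDist≤ (inj₁ (all-equal , _)) U∈D W∈D U≉W = contradiction (all-equal U∈D W∈D) U≉W
  minDist≤ (inj₂ (_ , minimal))   U∈D W∈D U≉W = minimal U∈D W∈D U≉W

  ≈-isEquivalence : IsEquivalence _≈_
  ≈-isEquivalence = record
    { refl  = (λ _ v∈ → v∈) , (λ _ v∈ → v∈)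
    ; sym   = λ (U⊆W , W⊆U) → W⊆U , U⊆W
    ; trans = λ (U⊆W , W⊆U) (W⊆X , X⊆W) → (λ v → W⊆X v ∘ U⊆W v) , (λ v → W⊆U v ∘ X⊆W v) }

module FlagCodes (𝔽 : FiniteField) (n : ℕ) {r : ℕ} (t : Fin r → ℕ) where
  open LinearAlgebra 𝔽 n using (Subspace; _≈_; _⊆_; Flag; sub; dims; nested; proj; Card; CardLe)
  open Subspaces 𝔽 n using (≈?; ≈-isEquivalence)

  sub-mono : (F : Flag t) {j i : Fin r} → j ≤ᶠ i → sub F j ⊆ sub F i
  sub-mono F {j} {i} j≤i with j Fin.≟ i
  ... | yes refl = λ _ v∈ → v∈
  ... | no j≢i   = proj₁ (nested F j i (Fin.≤∧≢⇒< j≤i j≢i))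

  _≈[_]_ : Flag t → Fin r → Flag t → Set
  F ≈[ j ] G = sub F j ≈ sub G j

  ≈[_]-isEquivalence : ∀ j → IsEquivalence _≈[ j ]_
  ≈[ j ]-isEquivalence = On.isEquivalence (λ F → sub F j) {≈ = _≈_} ≈-isEquivalence

  ≈[_]-decSetoid : Fin r → DecSetoid (Level.suc 0ℓ) 0ℓ
  ≈[ j ]-decSetoid = record
    { Carrier = Flag t
    ; _≈_ = _≈[ j ]_
    ; isDecEquivalence = record
      { isEquivalence = ≈[ j ]-isEquivalence
      ; _≟_ = λ F G → ≈? (sub F j) (sub G j) (dims F j) (dims G j) } }

  distinct : Fin r → List (Flag t) → List (Flag t)
  distinct j = List.deduplicate (DecSetoid._≟_ ≈[ j ]-decSetoid)

  module _ (C : List (Flag t)) (j : Fin r) where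

    distinct-⊆ : ∀ {F} → F ∈ distinct j C → F ∈ C
    distinct-⊆ = ∈-deduplicate⁻ (DecSetoid._≟_ ≈[ j ]-decSetoid) C

    distinct-unique : AllPairs (λ F G → ¬ F ≈[ j ] G) (distinct j C)
    distinct-unique = deduplicate-! ≈[ j ]-decSetoid C

    distinct-covers : ∀ {F} → F ∈ C → Any (F ≈[ j ]_) (distinct j C)
    distinct-covers {F} F∈C = Any.deduplicate⁺ (DecSetoid._≟_ ≈[ j ]-decSetoid)
      (λ {G} {H} H≈G F≈G → ≈j.trans {F} {G} {H} F≈G (≈j.sym {H} {G} H≈G))
      (Any.map (λ { refl → ≈j.refl {F} }) F∈C)
      where module ≈j = IsEquivalence ≈[ j ]-isEquivalence

    card-proj : Card (proj C j) (length (distinct j C))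
    card-proj = List.map (λ F → sub F j) (distinct j C)
              , List.length-map _ (distinct j C)
              , AllPairs.map⁺ distinct-unique
              , covered
              , covering
      where
      covered : ∀ {U} → U ∈ List.map (λ F → sub F j) (distinct j C) → Σ Subspace λ W → W ∈ proj C j × U ≈ W
      covered U∈ with F , F∈ , refl ← ∈-map⁻ _ U∈ =
        sub F j , ∈-map⁺ _ (distinct-⊆ F∈) , IsEquivalence.refl ≈-isEquivalence {sub F j}
      covering : ∀ {W} → W ∈ proj C j → Σ Subspace λ U → U ∈ List.map (λ F → sub F j) (distinct j C) × W ≈ U
      covering W∈ with F , F∈C , refl ← ∈-map⁻ _ W∈ with G , G∈ , F≈G ← find (distinct-covers F∈C) =
        sub G j , ∈-map⁺ _ G∈ , F≈G

  cardLe-proj : (C : List (Flag t)) (i j : Fin r) →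
                (∀ {F G} → F ∈ C → G ∈ C → ¬ F ≈[ i ] G → ¬ F ≈[ j ] G) → CardLe (proj C i) (proj C j)
  cardLe-proj C i j separates = _ , _ , card-proj C i , card-proj C j ,
    length-≤-cover (λ {F G} → ≈j.sym {F} {G}) (λ {F G H} → ≈j.trans {F} {G} {H})
      (allPairs-restrict separates (ListAll.tabulate (distinct-⊆ C i)) (distinct-unique C i))
      (λ F∈ → distinct-covers C j (distinct-⊆ C i F∈))
    where module ≈j = IsEquivalence ≈[ j ]-isEquivalence

  module _ (C : List (Flag t)) (i : Fin r) where
    open LinearAlgebra 𝔽 n using (mem; ⊕-closed; HasDim; capMem; sumMem; DistS; MinDist)
    open Subspaces 𝔽 n
    open FieldVectors 𝔽 using (𝟘)

    private
      proj∈ : ∀ {F} → F ∈ C → sub F i ∈ proj C i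
      proj∈ = ∈-map⁺ (λ F → sub F i)

    module SmallDimension (max : MinDist (proj C i) (2 * t i)) where

      cap-trivial-below : ∀ {F G} → F ∈ C → G ∈ C → ¬ F ≈[ i ] G → ∀ {j} → j ≤ᶠ i →
                          ∀ v → capMem (sub F j) (sub G j) v → v ≡ 𝟘 n
      cap-trivial-below {F} {G} F∈C G∈C F≉G j≤i v (v∈Fj , v∈Gj) =
        cap-trivial-of-dist (sub F i) (sub G i) (dims F i) (dims G i) (minDist≤ max (proj∈ F∈C) (proj∈ G∈C) F≉G)
                            v (sub-mono F j≤i v v∈Fj , sub-mono G j≤i v v∈Gj)

      distance-below : (F G : Flag t) → F ∈ C → G ∈ C → ¬ F ≈[ i ] G → (j : Fin r) → j ≤ᶠ i →
                       DistS (sub F j) (sub G j) (2 * t j)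
      distance-below F G F∈C G∈C F≉G j j≤i =
        dist-of-cap-trivial (sub F j) (sub G j) (dims F j) (dims G j) (cap-trivial-below F∈C G∈C F≉G j≤i)

      separates-below : (∀ j → 0 < t j) → ∀ {j} → j ≤ᶠ i →
                        ∀ {F G} → F ∈ C → G ∈ C → ¬ F ≈[ i ] G → ¬ F ≈[ j ] G
      separates-below 0<t {j} j≤i {F} F∈C G∈C F≉G (Fj⊆Gj , _)
        with t j | 0<t j | dims F j
      ... | suc _ | _ | dimFj with v , v∈Fj , v≢𝟘 ← nonzero-of-dim-suc dimFj =
        v≢𝟘 (cap-trivial-below F∈C G∈C F≉G j≤i v (v∈Fj , Fj⊆Gj v v∈Fj))

    module LargeDimension (max : MinDist (proj C i) (2 * (n ∸ t i))) where

      sum-full-above : ∀ {F G} → F ∈ C → G ∈ C → ¬ F ≈[ i ] G → ∀ {j} → i ≤ᶠ j →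
                       ∀ v → sumMem (sub F j) (sub G j) v
      sum-full-above {F} {G} F∈C G∈C F≉G {j} i≤j v =
        +ˢ-mono (sub F i) (sub G i) (sub F j) (sub G j) (sub-mono F i≤j) (sub-mono G i≤j) v
          (sum-full-of-dist (sub F i) (sub G i) (dims F i) (dims G i) (minDist≤ max (proj∈ F∈C) (proj∈ G∈C) F≉G) v)

      distance-above : (F G : Flag t) → F ∈ C → G ∈ C → ¬ F ≈[ i ] G → (j : Fin r) → i ≤ᶠ j →
                       DistS (sub F j) (sub G j) (2 * (n ∸ t j))
      distance-above F G F∈C G∈C F≉G j i≤j =
        dist-of-sum-full (sub F j) (sub G j) (dims F j) (dims G j) (sum-full-above F∈C G∈C F≉G i≤j)

      separates-above : (∀ j → t j < n) → ∀ {j} → i ≤ᶠ j →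
                        ∀ {F G} → F ∈ C → G ∈ C → ¬ F ≈[ i ] G → ¬ F ≈[ j ] G
      separates-above t<n {j} i≤j {F} F∈C G∈C F≉G (_ , Gj⊆Fj) =
        ℕ.<-irrefl (dim-unique (dims F j) (full⇒dim-n Fj-full)) (t<n j)
        where
        Fj-full : ∀ v → mem (sub F j) v
        Fj-full v with u , w , u∈Fj , w∈Gj , refl ← sum-full-above F∈C G∈C F≉G i≤j v =
          ⊕-closed (sub F j) u∈Fj (Gj⊆Fj w w∈Gj)

proposition4p5 : (𝔽 : FiniteField) (n r : ℕ) (t : Fin r → ℕ)
    → LinearAlgebra.IsFlagType 𝔽 n t
    → (C : List (LinearAlgebra.Flag 𝔽 n t)) → LinearAlgebra.IsFlagCode 𝔽 n C
    → (i : Fin r) → LinearAlgebra.IsMaxDistCode 𝔽 n (t i) (LinearAlgebra.proj 𝔽 n C i)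
    → (2 * t i ≤ n
        → ((F F' : LinearAlgebra.Flag 𝔽 n t) → F ∈ C → F' ∈ C
            → ¬ LinearAlgebra._≈_ 𝔽 n (LinearAlgebra.sub F i) (LinearAlgebra.sub F' i)
            → (j : Fin r) → j ≤ᶠ i
            → LinearAlgebra.DistS 𝔽 n (LinearAlgebra.sub F j) (LinearAlgebra.sub F' j) (2 * t j))
          × ((j : Fin r) → j ≤ᶠ i
            → LinearAlgebra.CardLe 𝔽 n (LinearAlgebra.proj 𝔽 n C i) (LinearAlgebra.proj 𝔽 n C j)))
    × (n ≤ 2 * t i
        → ((F F' : LinearAlgebra.Flag 𝔽 n t) → F ∈ C → F' ∈ C
            → ¬ LinearAlgebra._≈_ 𝔽 n (LinearAlgebra.sub F i) (LinearAlgebra.sub F' i)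
            → (j : Fin r) → i ≤ᶠ j
            → LinearAlgebra.DistS 𝔽 n (LinearAlgebra.sub F j) (LinearAlgebra.sub F' j) (2 * (n ∸ t j)))
          × ((j : Fin r) → i ≤ᶠ j
            → LinearAlgebra.CardLe 𝔽 n (LinearAlgebra.proj 𝔽 n C i) (LinearAlgebra.proj 𝔽 n C j)))
proposition4p5 𝔽 n r t (0<t , t<n , _) C _ i (_ , max-small , max-large) =
  (λ 2t≤n → let open SmallDimension C i (max-small 2t≤n) in
     distance-below , λ j j≤i → cardLe-proj C i j (separates-below 0<t j≤i)) ,
  (λ n≤2t → let open LargeDimension C i (max-large n≤2t) in
     distance-above , λ j i≤j → cardLe-proj C i j (separates-above t<n i≤j))
  where open FlagCodes 𝔽 n t
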